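{- Let $r \ge 2$ and let $G = K_{n_1,n_2,\ldots,n_r}$ be the complete $r$-partite graph with parts of sizes $n_1 \ge n_2 \ge \cdots \ge n_r \ge 1$, and let $n = n_1 + n_2 + \cdots + n_r$. If $3n_1 > 2n$, then $\mathrm{ip}(G) = \lceil n_1/2 \rceil$.
   Context: An isometric path between two vertices of a graph is a shortest path joining them. The isometric path number $\mathrm{ip}(G)$ of a graph $G$ is the minimum number of isometric paths (in $G$) needed to cover all vertices of $G$. The complete $r$-partite graph $K_{n_1,\ldots,n_r}$ has vertex set partitioned into $r$ nonempty parts of sizes $n_1,\ldots,n_r$, with two vertices adjacent if and only if they lie in different parts. -}

module Defs where

open import Level using (Level)
open import Data.Nat using (ℕ; zero; suc; _≤_; s≤s)
open import Data.Fin using (Fin)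
import Data.Fin as Fin
open import Data.List using (List; []; _∷_; length; tabulate)
open import Data.Nat.ListAction using (sum)
open import Data.List.Relation.Unary.Linked using (Linked)
open import Data.List.Relation.Unary.Any using (Any)
open import Data.List.Membership.Propositional using (_∈_)
open import Data.Product using (Σ; _×_; proj₁)
open import Relation.Binary.PropositionalEquality using (_≡_; _≢_)

lastOr : {V : Set} → V → List V → V
lastOr u []       = u
lastOr _ (x ∷ xs) = lastOr x xs

record IsoPath {V : Set} (Adj : V → V → Set) : Set₁ where
  field
    start    : V
    rest     : List V
    walk     : Linked Adj (start ∷ rest)
    shortest : (ys : List V) → Linked Adj (start ∷ ys) →
               lastOr start ys ≡ lastOr start rest → length rest ≤ length ys

  vertices : List V
  vertices = start ∷ rest

open IsoPath public

Covers : {V : Set} {Adj : V → V → Set} → List (IsoPath Adj) → Set₁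
Covers {V} ps = (v : V) → Any (λ P → v ∈ vertices P) ps

IsIsoPathNumber : {V : Set} → (Adj : V → V → Set) → ℕ → Set₁
IsIsoPathNumber Adj k =
  Σ (List (IsoPath Adj)) (λ ps → length ps ≡ k × Covers ps)
  × ((ps : List (IsoPath Adj)) → Covers ps → k ≤ length ps)

-- Complete r-partite graph K_{n(0),…,n(r-1)}: vertex (i , a) is the a-th vertex of part i;
-- two vertices are adjacent iff they lie in different parts.
MultipartiteV : (r : ℕ) → (Fin r → ℕ) → Set
MultipartiteV r n = Σ (Fin r) (λ i → Fin (n i))

MultipartiteAdj : (r : ℕ) (n : Fin r → ℕ) → MultipartiteV r n → MultipartiteV r n → Set
MultipartiteAdj r n x y = proj₁ x ≢ proj₁ y

total : (r : ℕ) → (Fin r → ℕ) → ℕ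
total r n = sum (tabulate n)

firstPart : {r : ℕ} → 2 ≤ r → Fin r
firstPart (s≤s _) = Fin.zero

{-# OPTIONS --safe #-}
module Submission where

-- Any two vertices are at distance at most 2, so an isometric path has at most three vertices;
-- consecutive ones lie in different parts, so at most two of them lie in the first part, and
-- covering its n₁ vertices needs ⌈n₁/2⌉ paths. Conversely 3n₁ > 2n means the n − n₁ other
-- vertices are fewer than n₁/2: pair up the vertices of the first part and join each pair
-- a, a′ by a path a – b – a′ through its own outside vertex b (any outside vertex once these
-- run out), which is isometric because a and a′ are not adjacent.

open import Defs
open import Data.Nat using (ℕ; _≤_; _<_; _*_; ⌈_/2⌉; zero; suc; s≤s; z≤n; _+_)
open import Data.Nat.Properties
  using (≤-refl; ≤-trans; <⇒≤; +-mono-≤; +-comm; +-cancelˡ-<; *-distribˡ-+; ⌈n/2⌉-mono; n≡⌈n+n/2⌉; module ≤-Reasoning)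
open import Data.Fin using (Fin)
import Data.Fin as Fin
open import Data.Fin.Properties using (injective⇒≤)
open import Data.List using (List; []; _∷_; length; filter; map; concatMap; _++_; allFin; lookup; head; drop)
open import Data.List.Properties using (length-filter; length-++; length-map; length-tabulate)
open import Data.List.Relation.Unary.Linked using (Linked; [-]; _∷_)
open import Data.List.Relation.Unary.Any using (Any; here; there; index)
open import Data.List.Relation.Unary.Any.Properties using (lookup-index)
open import Data.List.Relation.Unary.All using (_∷_)
open import Data.List.Relation.Unary.AllPairs using (AllPairs; _∷_)
open import Data.List.Relation.Unary.Unique.Propositional.Properties using (allFin⁺)
open import Data.List.Membership.Propositional using (_∈_)
open import Data.List.Membership.Propositional.Properties using (∈-++⁺ˡ; ∈-++⁺ʳ; ∈-map⁺; ∈-allFin; ∈-filter⁺)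
open import Data.Maybe using (fromMaybe)
open import Data.Product using (Σ; _×_; proj₁; _,_)
open import Function using (_∘_; id)
open import Function.Definitions using (Injective)
open import Relation.Nullary using (¬_; yes; no; contradiction)
open import Relation.Unary using (Decidable)
open import Relation.Binary.PropositionalEquality using (_≡_; _≢_; refl; sym; trans; cong; cong₂; subst; module ≡-Reasoning)

⌈n/2⌉≤m : ∀ {m n} → n ≤ 2 * m → ⌈ n /2⌉ ≤ m
⌈n/2⌉≤m {m} {n} n≤2m = begin
  ⌈ n /2⌉           ≤⟨ ⌈n/2⌉-mono n≤2m ⟩
  ⌈ m + (m + 0) /2⌉ ≡⟨ cong (λ k → ⌈ m + k /2⌉) (+-comm m 0) ⟩
  ⌈ m + m /2⌉       ≡⟨ sym (n≡⌈n+n/2⌉ m) ⟩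
  m                 ∎
  where open ≤-Reasoning

m≤⌈n/2⌉ : ∀ {m n} → 2 * m ≤ n → m ≤ ⌈ n /2⌉
m≤⌈n/2⌉ {m} {n} 2m≤n = begin
  m                 ≡⟨ n≡⌈n+n/2⌉ m ⟩
  ⌈ m + m /2⌉       ≡⟨ cong (λ k → ⌈ m + k /2⌉) (+-comm 0 m) ⟩
  ⌈ m + (m + 0) /2⌉ ≤⟨ ⌈n/2⌉-mono 2m≤n ⟩
  ⌈ n /2⌉           ∎
  where open ≤-Reasoning

2*[m+n]<3*m⇒2*n<m : ∀ m n → 2 * (m + n) < 3 * m → 2 * n < m
2*[m+n]<3*m⇒2*n<m m n 2[m+n]<3m = +-cancelˡ-< (2 * m) (2 * n) m (begin-strict
  2 * m + 2 * n ≡⟨ sym (*-distribˡ-+ 2 m n) ⟩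
  2 * (m + n)   <⟨ 2[m+n]<3m ⟩
  m + 2 * m     ≡⟨ +-comm m (2 * m) ⟩
  2 * m + m     ∎)
  where open ≤-Reasoning

injective⇒≤length : ∀ {A : Set} {k} {xs : List A} (f : Fin k → A) →
  Injective _≡_ _≡_ f → (∀ a → f a ∈ xs) → k ≤ length xs
injective⇒≤length {xs = xs} f f-injective f∈xs = injective⇒≤ {f = position} position-injective
  where
  position : _ → Fin (length xs)
  position a = index (f∈xs a)
  position-injective : Injective _≡_ _≡_ position
  position-injective {a} {b} eq = f-injective (begin
    f a                      ≡⟨ lookup-index (f∈xs a) ⟩
    lookup xs (position a)   ≡⟨ cong (lookup xs) eq ⟩
    lookup xs (position b)   ≡⟨ sym (lookup-index (f∈xs b)) ⟩
    f b                      ∎)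
    where open ≡-Reasoning

Walk≤ : {V : Set} → (V → V → Set) → ℕ → V → V → Set
Walk≤ {V} Adj d u v = Σ (List V) λ ys → Linked Adj (u ∷ ys) × lastOr u ys ≡ v × length ys ≤ d

module _ {V : Set} {Adj : V → V → Set} where

  isoPath-length≤ : ∀ {d} → (∀ u v → Walk≤ Adj d u v) → (p : IsoPath Adj) → length (rest p) ≤ d
  isoPath-length≤ connected p =
    let ys , ys-walk , ys-end , |ys|≤d = connected (start p) (lastOr (start p) (rest p))
    in ≤-trans (shortest p ys ys-walk ys-end) |ys|≤d

  edgePath : ∀ {u v} → u ≢ v → Adj u v → IsoPath Adj
  edgePath {u} {v} u≢v uv = record { start = u ; rest = v ∷ [] ; walk = uv ∷ [-] ; shortest = isShortest }
    where
    isShortest : (ys : List V) → Linked Adj (u ∷ ys) → lastOr u ys ≡ v → 1 ≤ length ys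
    isShortest []      _ u≡v = contradiction u≡v u≢v
    isShortest (_ ∷ _) _ _   = s≤s z≤n

  twoEdgePath : ∀ {u w v} → u ≢ v → ¬ Adj u v → Adj u w → Adj w v → IsoPath Adj
  twoEdgePath {u} {w} {v} u≢v u≁v uw wv =
    record { start = u ; rest = w ∷ v ∷ [] ; walk = uw ∷ wv ∷ [-] ; shortest = isShortest }
    where
    isShortest : (ys : List V) → Linked Adj (u ∷ ys) → lastOr u ys ≡ v → 2 ≤ length ys
    isShortest []          _          u≡v = contradiction u≡v u≢v
    isShortest (y ∷ [])    (uy ∷ [-]) y≡v = contradiction (subst (Adj u) y≡v uy) u≁v
    isShortest (_ ∷ _ ∷ _) _          _   = s≤s (s≤s z≤n)

  module _ {P : V → Set} (P? : Decidable P) (independent : ∀ {u v} → P u → P v → ¬ Adj u v) where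

    length-filter-walk≤2 : ∀ {u xs} → Linked Adj (u ∷ xs) → length xs ≤ 2 → length (filter P? (u ∷ xs)) ≤ 2
    length-filter-walk≤2 {u} {[]}         _ _ = ≤-trans (length-filter P? (u ∷ [])) (s≤s z≤n)
    length-filter-walk≤2 {u} {x ∷ []}     _ _ = length-filter P? (u ∷ x ∷ [])
    length-filter-walk≤2 {u} {x ∷ y ∷ []} (ux ∷ _) _ with P? u
    ... | no _ = length-filter P? (x ∷ y ∷ [])
    ... | yes Pu with P? x
    ...   | yes Px = contradiction ux (independent Pu Px)
    ...   | no _   = s≤s (length-filter P? (y ∷ []))
    length-filter-walk≤2 {xs = _ ∷ _ ∷ _ ∷ _} _ (s≤s (s≤s ()))

    filterVertices : List (IsoPath Adj) → List V
    filterVertices = concatMap (filter P? ∘ vertices)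

    length-filterVertices : (∀ (p : IsoPath Adj) → length (rest p) ≤ 2) →
      ∀ ps → length (filterVertices ps) ≤ 2 * length ps
    length-filterVertices _     []       = z≤n
    length-filterVertices short (p ∷ ps) = begin
      length (filter P? (vertices p) ++ filterVertices ps)
        ≡⟨ length-++ (filter P? (vertices p)) ⟩
      length (filter P? (vertices p)) + length (filterVertices ps)
        ≤⟨ +-mono-≤ (length-filter-walk≤2 (walk p) (short p)) (length-filterVertices short ps) ⟩
      2 + 2 * length ps
        ≡⟨ sym (*-distribˡ-+ 2 1 (length ps)) ⟩
      2 * length (p ∷ ps)
        ∎
      where open ≤-Reasoning

    ∈-filterVertices : ∀ {v ps} → P v → Any (λ p → v ∈ vertices p) ps → v ∈ filterVertices ps
    ∈-filterVertices Pv (here v∈p)           = ∈-++⁺ˡ (∈-filter⁺ P? v∈p Pv)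
    ∈-filterVertices Pv (there {x = p} v∈ps) = ∈-++⁺ʳ (filter P? (vertices p)) (∈-filterVertices Pv v∈ps)

    cover-lower-bound : (∀ (p : IsoPath Adj) → length (rest p) ≤ 2) →
      ∀ {k} (f : Fin k → V) → Injective _≡_ _≡_ f → (∀ a → P (f a)) →
      (ps : List (IsoPath Adj)) → Covers ps → ⌈ k /2⌉ ≤ length ps
    cover-lower-bound short f f-injective Pf ps covers = ⌈n/2⌉≤m (≤-trans
      (injective⇒≤length f f-injective (λ a → ∈-filterVertices (Pf a) (covers (f a))))
      (length-filterVertices short ps))

module Join {V A B : Set} {Adj : V → V → Set} (left : A → V) (right : B → V)
  (left-injective : Injective _≡_ _≡_ left)
  (left-independent : ∀ a a′ → ¬ Adj (left a) (left a′))
  (left-right : ∀ a b → Adj (left a) (right b))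
  (right-left : ∀ b a → Adj (right b) (left a)) where

  left≢right : ∀ a b → left a ≢ right b
  left≢right a b a≡b = left-independent a a (subst (Adj (left a)) (sym a≡b) (left-right a b))

  pairPaths : (as : List A) → AllPairs _≢_ as → B → List B → List (IsoPath Adj)
  pairPaths []            _                         _ _  = []
  pairPaths (a ∷ [])      _                         w bs = edgePath (left≢right a b) (left-right a b) ∷ []
    where b = fromMaybe w (head bs)
  pairPaths (a ∷ a′ ∷ as) ((a≢a′ ∷ _) ∷ (_ ∷ as≢)) w bs =
    twoEdgePath (a≢a′ ∘ left-injective) (left-independent a a′) (left-right a b) (right-left b a′)
      ∷ pairPaths as as≢ w (drop 1 bs)
    where b = fromMaybe w (head bs)

  length-pairPaths : ∀ as as≢ w bs → length (pairPaths as as≢ w bs) ≡ ⌈ length as /2⌉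
  length-pairPaths []           _                     _ _  = refl
  length-pairPaths (_ ∷ [])     _                     _ _  = refl
  length-pairPaths (_ ∷ _ ∷ as) ((_ ∷ _) ∷ (_ ∷ as≢)) w bs = cong suc (length-pairPaths as as≢ w (drop 1 bs))

  left-covered : ∀ {a} as as≢ w bs → a ∈ as → Any (λ p → left a ∈ vertices p) (pairPaths as as≢ w bs)
  left-covered (_ ∷ [])      _                     _ _  (here refl)         = here (here refl)
  left-covered (_ ∷ _ ∷ _)   ((_ ∷ _) ∷ (_ ∷ _))   _ _  (here refl)         = here (here refl)
  left-covered (_ ∷ _ ∷ _)   ((_ ∷ _) ∷ (_ ∷ _))   _ _  (there (here refl)) = here (there (there (here refl)))
  left-covered (_ ∷ _ ∷ as)  ((_ ∷ _) ∷ (_ ∷ as≢)) w bs (there (there a∈as)) =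
    there (left-covered as as≢ w (drop 1 bs) a∈as)

  right-covered : ∀ {b} as as≢ w bs → length bs ≤ ⌈ length as /2⌉ → b ∈ bs →
    Any (λ p → right b ∈ vertices p) (pairPaths as as≢ w bs)
  right-covered (_ ∷ [])     _                     _ (_ ∷ [])     _          (here refl)  = here (there (here refl))
  right-covered (_ ∷ _ ∷ _)  ((_ ∷ _) ∷ (_ ∷ _))   _ (_ ∷ _)      _          (here refl)  = here (there (here refl))
  right-covered (_ ∷ _ ∷ as) ((_ ∷ _) ∷ (_ ∷ as≢)) w (_ ∷ bs)     (s≤s fits) (there b∈bs) =
    there (right-covered as as≢ w bs fits b∈bs)
  right-covered []           _                     _ (_ ∷ _)      ()         _
  right-covered (_ ∷ [])     _                     _ (_ ∷ _ ∷ _)  (s≤s ())   _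
  right-covered (_ ∷ [])     _                     _ (_ ∷ [])     _          (there ())

module _ {r : ℕ} {n : Fin r → ℕ} where

  inPart : (i : Fin r) → Fin (n i) → MultipartiteV r n
  inPart i a = i , a

  inPart-injective : ∀ {i} → Injective _≡_ _≡_ (inPart i)
  inPart-injective refl = refl

sucPart : ∀ {r} {m : Fin (suc r) → ℕ} → MultipartiteV r (m ∘ Fin.suc) → MultipartiteV (suc r) m
sucPart (i , a) = Fin.suc i , a

allVertices : (r : ℕ) (m : Fin r → ℕ) → List (MultipartiteV r m)
allVertices zero    _ = []
allVertices (suc r) m =
  map (inPart Fin.zero) (allFin (m Fin.zero)) ++ map (sucPart {m = m}) (allVertices r (m ∘ Fin.suc))

length-allVertices : ∀ r m → length (allVertices r m) ≡ total r m
length-allVertices zero    _ = refl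
length-allVertices (suc r) m = begin
  length (partZero ++ otherParts)      ≡⟨ length-++ partZero {otherParts} ⟩
  length partZero + length otherParts  ≡⟨ cong₂ _+_ length-partZero length-otherParts ⟩
  m Fin.zero + total r (m ∘ Fin.suc)   ∎
  where
  open ≡-Reasoning
  partZero : List (MultipartiteV (suc r) m)
  partZero = map (inPart Fin.zero) (allFin (m Fin.zero))
  otherParts : List (MultipartiteV (suc r) m)
  otherParts = map (sucPart {m = m}) (allVertices r (m ∘ Fin.suc))
  length-partZero : length partZero ≡ m Fin.zero
  length-partZero = trans (length-map _ (allFin (m Fin.zero))) (length-tabulate id)
  length-otherParts : length otherParts ≡ total r (m ∘ Fin.suc)
  length-otherParts =
    trans (length-map (sucPart {m = m}) (allVertices r (m ∘ Fin.suc))) (length-allVertices r (m ∘ Fin.suc))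

∈-allVertices : ∀ r m (v : MultipartiteV r m) → v ∈ allVertices r m
∈-allVertices (suc r) m (Fin.zero  , a) = ∈-++⁺ˡ (∈-map⁺ (inPart Fin.zero) (∈-allFin a))
∈-allVertices (suc r) m (Fin.suc i , a) =
  ∈-++⁺ʳ _ (∈-map⁺ (sucPart {m = m}) (∈-allVertices r (m ∘ Fin.suc) (i , a)))

module _ {r : ℕ} {n : Fin r → ℕ} where

  multipartite-walk≤2 : ((i : Fin r) → Σ (MultipartiteV r n) (λ v → i ≢ proj₁ v)) →
    ∀ u v → Walk≤ (MultipartiteAdj r n) 2 u v
  multipartite-walk≤2 outside u v with proj₁ u Fin.≟ proj₁ v
  ... | no  u≁v = v ∷ [] , u≁v ∷ [-] , refl , s≤s z≤n
  ... | yes u~v =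
    let w , u≁w = outside (proj₁ u)
    in w ∷ v ∷ [] , u≁w ∷ (λ w~v → u≁w (trans u~v (sym w~v))) ∷ [-] , refl , ≤-refl

  multipartite-cover-lower : ((i : Fin r) → Σ (MultipartiteV r n) (λ v → i ≢ proj₁ v)) →
    (i : Fin r) (ps : List (IsoPath (MultipartiteAdj r n))) → Covers ps → ⌈ n i /2⌉ ≤ length ps
  multipartite-cover-lower outside i =
    cover-lower-bound (λ v → proj₁ v Fin.≟ i) (λ u∈i v∈i u≁v → u≁v (trans u∈i (sym v∈i)))
      (isoPath-length≤ (multipartite-walk≤2 outside)) (inPart i) inPart-injective (λ _ → refl)

multipartite-cover-upper : (r : ℕ) (n : Fin (suc r) → ℕ) → MultipartiteV r (n ∘ Fin.suc) →
  total r (n ∘ Fin.suc) ≤ ⌈ n Fin.zero /2⌉ →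
  Σ (List (IsoPath (MultipartiteAdj (suc r) n))) λ ps → length ps ≡ ⌈ n Fin.zero /2⌉ × Covers ps
multipartite-cover-upper r n w fits =
  pairPaths as (allFin⁺ _) w bs ,
  trans (length-pairPaths as (allFin⁺ _) w bs) (cong ⌈_/2⌉ (length-tabulate id)) ,
  covers
  where
  open Join {Adj = MultipartiteAdj (suc r) n} (inPart Fin.zero) (sucPart {m = n})
    inPart-injective (λ _ _ 0≢0 → 0≢0 refl) (λ _ _ ()) (λ _ _ ())
  as = allFin (n Fin.zero)
  bs = allVertices r (n ∘ Fin.suc)
  bs-fits : length bs ≤ ⌈ length as /2⌉
  bs-fits = begin
    length bs             ≡⟨ length-allVertices r (n ∘ Fin.suc) ⟩
    total r (n ∘ Fin.suc) ≤⟨ fits ⟩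
    ⌈ n Fin.zero /2⌉      ≡⟨ cong ⌈_/2⌉ (sym (length-tabulate id)) ⟩
    ⌈ length as /2⌉       ∎
    where open ≤-Reasoning
  covers : Covers (pairPaths as (allFin⁺ _) w bs)
  covers (Fin.zero  , a) = left-covered as (allFin⁺ _) w bs (∈-allFin a)
  covers (Fin.suc i , a) =
    right-covered as (allFin⁺ _) w bs bs-fits (∈-allVertices r (n ∘ Fin.suc) (i , a))

lemma1 : (r : ℕ) (hr : 2 ≤ r) (n : Fin r → ℕ) →
    ((i j : Fin r) → i Fin.≤ j → n j ≤ n i) →
    ((i : Fin r) → 1 ≤ n i) →
    2 * total r n < 3 * n (firstPart hr) →
    IsIsoPathNumber (MultipartiteAdj r n) ⌈ n (firstPart hr) /2⌉
lemma1 (suc (suc r)) (s≤s (s≤s z≤n)) n _ nonempty 2n<3n₁ =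
  multipartite-cover-upper (suc r) n (Fin.zero , b)
    (m≤⌈n/2⌉ (<⇒≤ (2*[m+n]<3*m⇒2*n<m (n Fin.zero) (total (suc r) (n ∘ Fin.suc)) 2n<3n₁))) ,
  multipartite-cover-lower outside Fin.zero
  where
  a : Fin (n Fin.zero)
  a = Fin.fromℕ< (nonempty Fin.zero)
  b : Fin (n (Fin.suc Fin.zero))
  b = Fin.fromℕ< (nonempty (Fin.suc Fin.zero))
  outside : (i : Fin (suc (suc r))) → Σ (MultipartiteV (suc (suc r)) n) (λ v → i ≢ proj₁ v)
  outside Fin.zero    = (Fin.suc Fin.zero , b) , λ ()
  outside (Fin.suc _) = (Fin.zero , a) , λ ()
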